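{- Let $r\geq 3$, let $m$ be a positive integer and let $y_1,\dots,y_r\in\mathbb N_0$. Let \[ \mathcal C=\{\mathbf u\in P(m,r): \mathbf u(i)=y_i \text{ for some } i\in[r-2], \text{ or } \mathbf u(r-1)=0, \text{ or } \mathbf u(r)=0\}, \] \[ \mathcal D=\{\mathbf u\in P(m,r): \mathbf u(i)=y_i \text{ for some } i\in[r]\}. \] Then $\vert\mathcal D\vert\leq\vert\mathcal C\vert$.
   Context: $\mathbb N_0$ is the set of non-negative integers, $[k]=\{1,\dots,k\}$, and $P(m,r)=\{(x_1,\dots,x_r)\in\mathbb N_0^r : x_1+\cdots+x_r=m\}$; for $\mathbf u=(u_1,\dots,u_r)$, $\mathbf u(i)=u_i$. -}

module Defs where

open import Data.Nat using (ℕ; zero; suc; _+_; _∸_; _<_; _≟_)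
open import Data.Nat.Properties using (_<?_)
open import Data.Fin using (Fin; toℕ; fromℕ; inject₁)
open import Data.Vec using (Vec; []; _∷_; lookup)
open import Data.List using (List; []; _∷_; map; concatMap; filter; length; upTo)
open import Data.Product using (∃; _,_; _×_)
open import Data.Sum using (_⊎_)
open import Relation.Nullary using (Dec)
open import Relation.Unary using (Pred; Decidable)
open import Relation.Binary.PropositionalEquality using (_≡_)
open import Data.Fin.Properties using (any?)
open import Data.Sum using (inj₁; inj₂)
open import Relation.Nullary.Decidable using (_⊎-dec_)

vecSum : ∀ {r} → Vec ℕ r → ℕ
vecSum [] = 0
vecSum (x ∷ xs) = x + vecSum xs

-- comps m r : an explicit enumeration (without repetition) of
-- P(m,r) = { u ∈ ℕ₀^r : u(1)+...+u(r) = m }.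
comps : ℕ → (r : ℕ) → List (Vec ℕ r)
comps zero zero = [] ∷ []
comps (suc m) zero = []
comps m (suc r) = concatMap (λ x → map (x ∷_) (comps (m ∸ x) r)) (upTo (suc m))

-- Membership predicate of C (for r = k + 2, 0-based Fin indices):
-- u(i) = y_i for some i ∈ [r-2] (i.e. 0-based index < k),
-- or u(r-1) = 0 (0-based index k), or u(r) = 0 (0-based index k+1).
inC : ∀ k → Vec ℕ (suc (suc k)) → Vec ℕ (suc (suc k)) → Set
inC k y u =
  (∃ λ (i : Fin (suc (suc k))) → toℕ i < k × lookup u i ≡ lookup y i)
  ⊎ (lookup u (inject₁ (fromℕ k)) ≡ 0 ⊎ lookup u (fromℕ (suc k)) ≡ 0)

inC? : ∀ k y → Decidable (inC k y)
inC? k y u =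
  any? (λ i → _×-dec_ (toℕ i <? k) (lookup u i ≟ lookup y i))
  ⊎-dec ((lookup u (inject₁ (fromℕ k)) ≟ 0) ⊎-dec (lookup u (fromℕ (suc k)) ≟ 0))
  where open import Relation.Nullary.Decidable using (_×-dec_)

inD : ∀ {r} → Vec ℕ r → Vec ℕ r → Set
inD y u = ∃ λ i → lookup u i ≡ lookup y i

inD? : ∀ {r} (y : Vec ℕ r) → Decidable (inD y)
inD? y u = any? (λ i → lookup u i ≟ lookup y i)

cardC : ∀ k → ℕ → Vec ℕ (suc (suc k)) → ℕ
cardC k m y = length (filter (inC? k y) (comps m (suc (suc k))))

cardD : ∀ {r} → ℕ → Vec ℕ r → ℕ
cardD {r} m y = length (filter (inD? y) (comps m r))

-- Split P(m,r) according to the first coordinate x. If x = y₁, the whole slice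
-- lies in both C and D; otherwise membership in either set only depends on the
-- remaining coordinates, which is the same problem for r − 1 and m − x.  This
-- reduces everything to r = 2, where D has at most two elements (at most one
-- with u(1) = y₁ and at most one with u(2) = y₂), while for m > 0 the set C
-- contains the two distinct compositions (0,m) and (m,0).
module Submission where

open import Defs
open import Data.Nat using (ℕ; zero; suc; _+_; _∸_; _≤_; _<_; z≤n; s≤s; _≟_)
open import Data.Nat.Properties
  using (≤-trans; ≤-reflexive; m≤n⇒m≤1+n; +-suc; +-mono-≤; +-monoʳ-≤; n≤1+n; n<1+n; n∸n≡0; m<n⇒0<n∸m; ∸-cancelˡ-≡; ≤-pred; module ≤-Reasoning)
open import Data.Vec using (Vec; []; _∷_)
open import Data.List using (List; []; _∷_; _++_; [_]; map; concatMap; filter; length; upTo; applyUpTo)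
open import Data.List.Properties
  using (length-++; length-map; length-filter; filter-++; filter-≐; filter-all; filter-none; filter-accept; filter-some;
         concatMap-cong; concatMap-map; concatMap-pure; concatMap-++; upTo-∷ʳ)
open import Data.List.Membership.Propositional using (_∈_; lose)
open import Data.List.Membership.Propositional.Properties using (∈-upTo⁻; ∈-applyUpTo⁺)
open import Data.List.Relation.Unary.Any using (here; there)
open import Data.List.Relation.Unary.All as All using (All; []; _∷_; universal)
open import Data.List.Relation.Unary.All.Properties using (map⁺; applyUpTo⁺₁)
open import Data.List.Relation.Unary.Unique.Propositional using (Unique; []; _∷_)
open import Data.List.Relation.Unary.Unique.Propositional.Properties using (upTo⁺)
open import Data.Fin as Fin using ()
open import Data.Product using (_,_)
open import Data.Sum using (inj₁; inj₂)
open import Level using (Level)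
open import Relation.Nullary using (¬_; yes; no; contradiction)
open import Relation.Unary using (Pred; Decidable; _⊆_; _≐_; _∪_)
open import Relation.Unary.Properties using (_∪?_)
open import Relation.Binary.PropositionalEquality using (_≡_; _≢_; refl; sym; trans; cong; module ≡-Reasoning)
open import Function using (_∘_)

private
  variable
    a b p q : Level
    A B : Set a

count : {P : Pred A p} → Decidable P → List A → ℕ
count P? xs = length (filter P? xs)

module _ {P : Pred A p} (P? : Decidable P) where

  count-++ : ∀ xs ys → count P? (xs ++ ys) ≡ count P? xs + count P? ys
  count-++ xs ys = trans (cong length (filter-++ P? xs ys)) (length-++ (filter P? xs))

  count-map : (f : B → A) (xs : List B) → count P? (map f xs) ≡ count (P? ∘ f) xs
  count-map f [] = refl
  count-map f (x ∷ xs) with P? (f x)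
  ... | yes _ = cong suc (count-map f xs)
  ... | no _  = count-map f xs

  count-all : ∀ {xs} → All P xs → count P? xs ≡ length xs
  count-all Pxs = cong length (filter-all P? Pxs)

  count-accept : ∀ {x xs} → P x → count P? (x ∷ xs) ≡ suc (count P? xs)
  count-accept Px = cong length (filter-accept P? Px)

  count-≤1 : ∀ {xs} → Unique xs → (∀ {u v} → u ∈ xs → v ∈ xs → P u → P v → u ≡ v) →
             count P? xs ≤ 1
  count-≤1 [] _ = z≤n
  count-≤1 {x ∷ xs} (x∉xs ∷ uniq) unique-witness with P? x
  ... | yes Px = s≤s (≤-reflexive (cong length (filter-none P? (All.tabulate others-fail))))
    where
    others-fail : ∀ {v} → v ∈ xs → ¬ P v
    others-fail v∈xs Pv = All.lookup x∉xs v∈xs (unique-witness (here refl) (there v∈xs) Px Pv)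
  ... | no _ = count-≤1 uniq (λ u∈ v∈ → unique-witness (there u∈) (there v∈))

module _ {P : Pred A p} {Q : Pred A q} (P? : Decidable P) (Q? : Decidable Q) where

  count-cong : P ≐ Q → ∀ xs → count P? xs ≡ count Q? xs
  count-cong P≐Q xs = cong length (filter-≐ P? Q? P≐Q xs)

  count-mono : P ⊆ Q → ∀ xs → count P? xs ≤ count Q? xs
  count-mono P⊆Q [] = z≤n
  count-mono P⊆Q (x ∷ xs) with P? x | Q? x
  ... | yes _  | yes _ = s≤s (count-mono P⊆Q xs)
  ... | yes Px | no ¬Qx = contradiction (P⊆Q Px) ¬Qx
  ... | no _   | yes _ = m≤n⇒m≤1+n (count-mono P⊆Q xs)
  ... | no _   | no _  = count-mono P⊆Q xs

  count-∪ : ∀ xs → count (P? ∪? Q?) xs ≤ count P? xs + count Q? xs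
  count-∪ [] = z≤n
  count-∪ (x ∷ xs) with P? x | Q? x
  ... | yes _ | yes _ = s≤s (≤-trans (count-∪ xs) (+-monoʳ-≤ (count P? xs) (n≤1+n _)))
  ... | yes _ | no _  = s≤s (count-∪ xs)
  ... | no _  | yes _ = ≤-trans (s≤s (count-∪ xs)) (≤-reflexive (sym (+-suc (count P? xs) _)))
  ... | no _  | no _  = count-∪ xs

count-concatMap-mono : {P : Pred B p} {Q : Pred B q} (P? : Decidable P) (Q? : Decidable Q)
  (f : A → List B) → (∀ x → count P? (f x) ≤ count Q? (f x)) →
  ∀ xs → count P? (concatMap f xs) ≤ count Q? (concatMap f xs)
count-concatMap-mono P? Q? f block-≤ [] = z≤n
count-concatMap-mono P? Q? f block-≤ (x ∷ xs) = begin
  count P? (f x ++ concatMap f xs)            ≡⟨ count-++ P? (f x) _ ⟩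
  count P? (f x) + count P? (concatMap f xs)  ≤⟨ +-mono-≤ (block-≤ x) (count-concatMap-mono P? Q? f block-≤ xs) ⟩
  count Q? (f x) + count Q? (concatMap f xs)  ≡⟨ sym (count-++ Q? (f x) _) ⟩
  count Q? (f x ++ concatMap f xs)            ∎
  where open ≤-Reasoning

concatMap-[] : (f : A → List B) → ∀ {xs} → All (λ x → f x ≡ []) xs → concatMap f xs ≡ []
concatMap-[] f []            = refl
concatMap-[] f (fx≡[] ∷ rest) rewrite fx≡[] = concatMap-[] f rest

concatMap-singleton : (g : A → B) (f : A → List B) → (∀ x → f x ≡ [ g x ]) →
  ∀ xs → concatMap f xs ≡ map g xs
concatMap-singleton g f f≡[g] xs = begin
  concatMap f xs            ≡⟨ concatMap-cong f≡[g] xs ⟩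
  concatMap ([_] ∘ g) xs    ≡⟨ concatMap-map [_] g xs ⟨
  concatMap [_] (map g xs)  ≡⟨ concatMap-pure (map g xs) ⟩
  map g xs                  ∎
  where open ≡-Reasoning

-- Not definitional for a variable m: the clauses of comps split on m first.
comps-suc : ∀ m r → comps m (suc r) ≡ concatMap (λ x → map (x ∷_) (comps (m ∸ x) r)) (upTo (suc m))
comps-suc zero    r = refl
comps-suc (suc m) r = refl

comps-zero : ∀ {n} → 0 < n → comps n 0 ≡ []
comps-zero {suc n} _ = refl

comps-one : ∀ n → comps n 1 ≡ [ n ∷ [] ]
comps-one n = begin
  comps n 1                                  ≡⟨ comps-suc n 0 ⟩
  concatMap slice (upTo (suc n))             ≡⟨ cong (concatMap slice) (upTo-∷ʳ n) ⟨
  concatMap slice (upTo n ++ [ n ])          ≡⟨ concatMap-++ slice (upTo n) [ n ] ⟩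
  concatMap slice (upTo n) ++ slice n ++ []
    ≡⟨ cong (_++ slice n ++ []) (concatMap-[] slice (applyUpTo⁺₁ _ n empty-slice)) ⟩
  map (n ∷_) (comps (n ∸ n) 0) ++ []         ≡⟨ cong (λ j → map (n ∷_) (comps j 0) ++ []) (n∸n≡0 n) ⟩
  [ n ∷ [] ]                                 ∎
  where
  open ≡-Reasoning
  slice : ℕ → List (Vec ℕ 1)
  slice x = map (x ∷_) (comps (n ∸ x) 0)
  empty-slice : ∀ {x} → x < n → slice x ≡ []
  empty-slice x<n = cong (map _) (comps-zero (m<n⇒0<n∸m x<n))

pair : ℕ → ℕ → Vec ℕ 2
pair m x = x ∷ m ∸ x ∷ []

comps-two : ∀ m → comps m 2 ≡ map (pair m) (upTo (suc m))
comps-two m = trans (comps-suc m 1)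
  (concatMap-singleton (pair m) _ (λ x → cong (map (x ∷_)) (comps-one (m ∸ x))) (upTo (suc m)))

count-map-≐ : {P : Pred A p} {Q : Pred B q} (P? : Decidable P) (Q? : Decidable Q) (f : B → A) →
  (P ∘ f) ≐ Q → ∀ xs → count P? (map f xs) ≡ count Q? xs
count-map-≐ P? Q? f P∘f≐Q xs = trans (count-map P? f xs) (count-cong (P? ∘ f) Q? P∘f≐Q xs)

count-map-universal : {P : Pred A p} (P? : Decidable P) (f : B → A) → (∀ x → P (f x)) →
  ∀ xs → count P? (map f xs) ≡ length xs
count-map-universal P? f P∘f xs = trans (count-all P? (map⁺ (universal P∘f xs))) (length-map f xs)

cardD-two≤2 : ∀ m (y : Vec ℕ 2) → cardD m y ≤ 2
cardD-two≤2 m y@(y₁ ∷ y₂ ∷ []) = begin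
  cardD m y                           ≡⟨ cong (count (inD? y)) (comps-two m) ⟩
  count (inD? y) (map (pair m) xs)    ≡⟨ count-map (inD? y) (pair m) xs ⟩
  count (inD? y ∘ pair m) xs          ≤⟨ count-mono (inD? y ∘ pair m) (first? ∪? second?) coordinate xs ⟩
  count (first? ∪? second?) xs        ≤⟨ count-∪ first? second? xs ⟩
  count first? xs + count second? xs  ≤⟨ +-mono-≤ (count-≤1 first? (upTo⁺ _) first-unique)
                                                  (count-≤1 second? (upTo⁺ _) second-unique) ⟩
  2                                   ∎
  where
  open ≤-Reasoning
  xs = upTo (suc m)
  first? : Decidable (_≡ y₁)
  first? x = x ≟ y₁
  second? : Decidable (λ x → m ∸ x ≡ y₂)
  second? x = m ∸ x ≟ y₂
  coordinate : (inD y ∘ pair m) ⊆ ((_≡ y₁) ∪ (λ x → m ∸ x ≡ y₂))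
  coordinate (Fin.zero , u₁≡y₁)          = inj₁ u₁≡y₁
  coordinate (Fin.suc Fin.zero , u₂≡y₂) = inj₂ u₂≡y₂
  first-unique : ∀ {u v} → u ∈ xs → v ∈ xs → u ≡ y₁ → v ≡ y₁ → u ≡ v
  first-unique _ _ u≡y₁ v≡y₁ = trans u≡y₁ (sym v≡y₁)
  second-unique : ∀ {u v} → u ∈ xs → v ∈ xs → m ∸ u ≡ y₂ → m ∸ v ≡ y₂ → u ≡ v
  second-unique u∈xs v∈xs e₁ e₂ =
    ∸-cancelˡ-≡ (≤-pred (∈-upTo⁻ u∈xs)) (≤-pred (∈-upTo⁻ v∈xs)) (trans e₁ (sym e₂))

2≤cardC-two : ∀ m (y : Vec ℕ 2) → 2 ≤ cardC 0 (suc m) y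
2≤cardC-two m y = begin
  2                                     ≤⟨ s≤s (filter-some C∘pair? (lose m∈rest (inj₂ (inj₂ (n∸n≡0 m))))) ⟩
  suc (count C∘pair? rest)              ≡⟨ count-accept C∘pair? {xs = rest} (inj₂ (inj₁ refl)) ⟨
  count C∘pair? (0 ∷ rest)              ≡⟨ count-map (inC? 0 y) (pair (suc m)) (upTo (2 + m)) ⟨
  count (inC? 0 y) (map (pair (suc m)) (upTo (2 + m)))  ≡⟨ cong (count (inC? 0 y)) (comps-two (suc m)) ⟨
  cardC 0 (suc m) y                     ∎
  where
  open ≤-Reasoning
  C∘pair? = inC? 0 y ∘ pair (suc m)
  rest = applyUpTo suc (suc m)
  m∈rest : suc m ∈ rest
  m∈rest = ∈-applyUpTo⁺ suc (n<1+n m)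

cardD≤cardC-two : ∀ m (y : Vec ℕ 2) → cardD m y ≤ cardC 0 m y
cardD≤cardC-two zero    y = length-filter (inD? y) (comps 0 2)
cardD≤cardC-two (suc m) y = ≤-trans (cardD-two≤2 (suc m) y) (2≤cardC-two m y)

module _ {x y₀ : ℕ} where

  inD-∷-head : ∀ {r} {y : Vec ℕ r} → x ≡ y₀ → ∀ u → inD (y₀ ∷ y) (x ∷ u)
  inD-∷-head x≡y₀ u = Fin.zero , x≡y₀

  inC-∷-head : ∀ {k} {y : Vec ℕ (2 + k)} → x ≡ y₀ → ∀ u → inC (suc k) (y₀ ∷ y) (x ∷ u)
  inC-∷-head x≡y₀ u = inj₁ (Fin.zero , s≤s z≤n , x≡y₀)

  inD-∷-tail : ∀ {r} {y : Vec ℕ r} → x ≢ y₀ → (inD (y₀ ∷ y) ∘ (x ∷_)) ≐ inD y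
  inD-∷-tail {y = y} x≢y₀ = to , from
    where
    to : ∀ {u} → inD (y₀ ∷ y) (x ∷ u) → inD y u
    to (Fin.zero  , x≡y₀)  = contradiction x≡y₀ x≢y₀
    to (Fin.suc i , uᵢ≡yᵢ) = i , uᵢ≡yᵢ
    from : ∀ {u} → inD y u → inD (y₀ ∷ y) (x ∷ u)
    from (i , uᵢ≡yᵢ) = Fin.suc i , uᵢ≡yᵢ

  inC-∷-tail : ∀ {k} {y : Vec ℕ (2 + k)} → x ≢ y₀ → (inC (suc k) (y₀ ∷ y) ∘ (x ∷_)) ≐ inC k y
  inC-∷-tail {k} {y} x≢y₀ = to , from
    where
    to : ∀ {u} → inC (suc k) (y₀ ∷ y) (x ∷ u) → inC k y u
    to (inj₁ (Fin.zero  , _       , x≡y₀))  = contradiction x≡y₀ x≢y₀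
    to (inj₁ (Fin.suc i , s≤s i<k , uᵢ≡yᵢ)) = inj₁ (i , i<k , uᵢ≡yᵢ)
    to (inj₂ last-two-zero)                 = inj₂ last-two-zero
    from : ∀ {u} → inC k y u → inC (suc k) (y₀ ∷ y) (x ∷ u)
    from (inj₁ (i , i<k , uᵢ≡yᵢ)) = inj₁ (Fin.suc i , s≤s i<k , uᵢ≡yᵢ)
    from (inj₂ last-two-zero)     = inj₂ last-two-zero

cardD≤cardC : ∀ k m (y : Vec ℕ (2 + k)) → cardD m y ≤ cardC k m y
cardD≤cardC zero    m y = cardD≤cardC-two m y
cardD≤cardC (suc k) m y@(y₀ ∷ y') = begin
  cardD m y                                       ≡⟨ cong (count (inD? y)) (comps-suc m _) ⟩
  count (inD? y) (concatMap slice (upTo (suc m)))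
    ≤⟨ count-concatMap-mono (inD? y) (inC? (suc k) y) slice slice-≤ (upTo (suc m)) ⟩
  count (inC? (suc k) y) (concatMap slice (upTo (suc m)))  ≡⟨ cong (count (inC? (suc k) y)) (comps-suc m _) ⟨
  cardC (suc k) m y                               ∎
  where
  open ≤-Reasoning
  slice : ℕ → List (Vec ℕ (3 + k))
  slice x = map (x ∷_) (comps (m ∸ x) (2 + k))
  slice-≤ : ∀ x → count (inD? y) (slice x) ≤ count (inC? (suc k) y) (slice x)
  slice-≤ x with x ≟ y₀
  ... | yes x≡y₀ = ≤-reflexive (trans
          (count-map-universal (inD? y) (x ∷_) (inD-∷-head x≡y₀) us)
          (sym (count-map-universal (inC? (suc k) y) (x ∷_) (inC-∷-head x≡y₀) us)))
    where us = comps (m ∸ x) (2 + k)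
  ... | no x≢y₀ = begin
    count (inD? y) (slice x)          ≡⟨ count-map-≐ (inD? y) (inD? y') (x ∷_) (inD-∷-tail x≢y₀) us ⟩
    cardD (m ∸ x) y'                  ≤⟨ cardD≤cardC k (m ∸ x) y' ⟩
    cardC k (m ∸ x) y'                ≡⟨ count-map-≐ (inC? (suc k) y) (inC? k y') (x ∷_) (inC-∷-tail x≢y₀) us ⟨
    count (inC? (suc k) y) (slice x)  ∎
    where us = comps (m ∸ x) (2 + k)

lemma2p1 : (k : ℕ) → 1 ≤ k → (m : ℕ) → 0 < m → (y : Vec ℕ (suc (suc k))) →
    cardD m y ≤ cardC k m y
lemma2p1 k _ m _ y = cardD≤cardC k m y
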